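{- Let $\alpha>1$. Suppose a maximal $\alpha$-gapped repeat $\sigma$ in a word $w$ is covered by a maximal repeat $\sigma'$. Then $\sigma'$ is either an overlapped repeat or an $\alpha$-gapped repeat.
   Context: For a factor $w[i..j]$ we write $\mathrm{beg}=i$ and $\mathrm{end}=j$. A repeat $\sigma$ is a pair $(u',u'')$ of nonempty factors of $w$ (of length $n$) that are equal as words, with $\mathrm{beg}(u')<\mathrm{beg}(u'')$. Its copy length is $c(\sigma)=|u'|$ and its period is $p(\sigma)=\mathrm{beg}(u'')-\mathrm{beg}(u')$. We set $\mathrm{fact}(\sigma)=w[\mathrm{beg}(u')..\mathrm{end}(u'')]$. The repeat is maximal if two conditions hold: if $\mathrm{beg}(u')>1$ then $w[\mathrm{beg}(u')-1]\ne w[\mathrm{beg}(u'')-1]$, and if $\mathrm{end}(u'')<n$ then $w[\mathrm{end}(u')+1]\ne w[\mathrm{end}(u'')+1]$. It is overlapped if $\mathrm{beg}(u'')\le \mathrm{end}(u')+1$, and gapped otherwise. A gapped repeat is $\alpha$-gapped if $p(\sigma)\le\alpha c(\sigma)$. A maximal repeat $\sigma$ is covered by a maximal repeat $\sigma'$ if $\mathrm{fact}(\sigma)$ is contained in $\mathrm{fact}(\sigma')$ and $p(\sigma')<p(\sigma)$. Here a factor $u$ is contained in a factor $v$ if $\mathrm{beg}(v)\le\mathrm{beg}(u)$ and $\mathrm{end}(u)\le\mathrm{end}(v)$.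
   Formalization: The parameter α ranges over the rationals greater than 1. -}

module Defs where

open import Data.Nat using (ℕ; zero; suc; _+_; _∸_; _≤_; _<_)
open import Data.List using (List; []; _∷_; length)
open import Data.Maybe using (Maybe; just; nothing)
open import Data.Integer using (+_)
open import Data.Product using (_×_)
open import Data.Sum using (_⊎_)
open import Relation.Nullary using (¬_)
open import Relation.Binary.PropositionalEquality using (_≡_; _≢_)
import Data.Rational as ℚ
open ℚ using (ℚ)

-- 1-based access: w [ k ] is the k-th letter of w (k = 1 .. length w),
-- and nothing outside that range.
_[_] : ∀ {a} {A : Set a} → List A → ℕ → Maybe A
[] [ _ ] = nothing
(x ∷ xs) [ zero ] = nothing
(x ∷ xs) [ suc zero ] = just x
(x ∷ xs) [ suc (suc k) ] = xs [ suc k ]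

-- A repeat σ = (u', u'') in w is given by beg(u') = b₁, beg(u'') = b₂ and
-- the copy length c = |u'| = |u''|, so that
--   u' = w[b₁ .. b₁+c-1],  u'' = w[b₂ .. b₂+c-1].
record Repeat {a} {A : Set a} (w : List A) : Set a where
  constructor repeat
  field
    b₁ b₂ c : ℕ
    b₁≥1    : 1 ≤ b₁
    c≥1     : 1 ≤ c
    b₁<b₂   : b₁ < b₂
    inWord  : b₂ + c ∸ 1 ≤ length w
    equal   : ∀ k → k < c → w [ b₁ + k ] ≡ w [ b₂ + k ]

module _ {a} {A : Set a} {w : List A} where
  open Repeat

  end₁ end₂ : Repeat w → ℕ
  end₁ σ = b₁ σ + c σ ∸ 1
  end₂ σ = b₂ σ + c σ ∸ 1

  period : Repeat w → ℕ
  period σ = b₂ σ ∸ b₁ σ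

  factFrom factTo : Repeat w → ℕ
  factFrom σ = b₁ σ
  factTo σ = end₂ σ

  Maximal : Repeat w → Set a
  Maximal σ =
    (1 < b₁ σ → w [ b₁ σ ∸ 1 ] ≢ w [ b₂ σ ∸ 1 ])
    × (end₂ σ < length w → w [ end₁ σ + 1 ] ≢ w [ end₂ σ + 1 ])

  Overlapped : Repeat w → Set
  Overlapped σ = b₂ σ ≤ end₁ σ + 1

  Gapped : Repeat w → Set
  Gapped σ = end₁ σ + 1 < b₂ σ

  AlphaGapped : ℚ → Repeat w → Set
  AlphaGapped α σ = Gapped σ × (+ period σ ℚ./ 1) ℚ.≤ α ℚ.* (+ c σ ℚ./ 1)

  CoveredBy : Repeat w → Repeat w → Set a
  CoveredBy σ σ′ =
    Maximal σ × Maximal σ′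
    × factFrom σ′ ≤ factFrom σ × factTo σ ≤ factTo σ′
    × period σ′ < period σ

-- A covering repeat σ′ starts no later and ends no earlier than σ while having a smaller
-- period, so its second copy starts strictly before that of σ and is therefore longer:
-- c(σ) < c(σ′). Hence p(σ′) < p(σ) ≤ α c(σ) ≤ α c(σ′), and σ′, if not overlapped, is
-- gapped with period at most α c(σ′).
module Submission where

open import Defs
open import Data.List using (List)
open import Data.Nat as ℕ using (z≤n)
open import Data.Nat.Properties
  using (≤-trans; <⇒≤; <⇒≱; ≰⇒>; _≤?_; m≤n+m; m∸n+n≡m; +-monoˡ-≤; +-monoˡ-<; +-monoʳ-≤;
         +-mono-<-≤; module ≤-Reasoning)
open import Data.Nat.Coprimality using (1-coprimeTo) renaming (sym to coprime-sym)
open import Data.Integer as ℤ using (+_; +≤+)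
open import Data.Product using (_,_)
open import Data.Sum using (_⊎_; inj₁; inj₂)
open import Data.Rational as ℚ using (ℚ; 1ℚ; _<_; NonNegative)
import Data.Rational.Properties as ℚ
import Data.Integer.Properties as ℤ
open import Relation.Binary.PropositionalEquality using (_≡_; sym; subst₂)
open import Relation.Nullary using (yes; no)

m∸n<o∸p⇒m<o : ∀ {m n o p} → n ℕ.≤ m → p ℕ.≤ o → n ℕ.≤ p → m ℕ.∸ n ℕ.< o ℕ.∸ p → m ℕ.< o
m∸n<o∸p⇒m<o {m} {n} {o} {p} n≤m p≤o n≤p lt = begin-strict
  m             ≡⟨ m∸n+n≡m n≤m ⟨
  m ℕ.∸ n ℕ.+ n <⟨ +-monoˡ-< n lt ⟩
  o ℕ.∸ p ℕ.+ n ≤⟨ +-monoʳ-≤ (o ℕ.∸ p) n≤p ⟩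
  o ℕ.∸ p ℕ.+ p ≡⟨ m∸n+n≡m p≤o ⟩
  o             ∎
  where open ≤-Reasoning

o<m⇒m+n≤o+p⇒n<p : ∀ {m n o p} → o ℕ.< m → m ℕ.+ n ℕ.≤ o ℕ.+ p → n ℕ.< p
o<m⇒m+n≤o+p⇒n<p o<m le = ≰⇒> λ p≤n → <⇒≱ (+-mono-<-≤ o<m p≤n) le

+/1≡mkℚ : ∀ n → + n ℚ./ 1 ≡ ℚ.mkℚ (+ n) 0 (coprime-sym (1-coprimeTo n))
+/1≡mkℚ n = ℚ.normalize-coprime (coprime-sym (1-coprimeTo n))

+/1-mono-≤ : ∀ {m n} → m ℕ.≤ n → + m ℚ./ 1 ℚ.≤ + n ℚ./ 1
+/1-mono-≤ {m} {n} m≤n rewrite +/1≡mkℚ m | +/1≡mkℚ n =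
  ℚ.*≤* (subst₂ ℤ._≤_ (sym (ℤ.*-identityʳ (+ m))) (sym (ℤ.*-identityʳ (+ n))) (+≤+ m≤n))

>1⇒nonNegative : ∀ {α} → 1ℚ < α → NonNegative α
>1⇒nonNegative 1<α = ℚ.nonNegative (ℚ.≤-trans (ℚ.*≤* (+≤+ z≤n)) (ℚ.<⇒≤ 1<α))

module _ {a} {A : Set a} {w : List A} where
  open Repeat

  PeriodAtMost : ℚ → Repeat w → Set
  PeriodAtMost α σ = + period σ ℚ./ 1 ℚ.≤ α ℚ.* (+ c σ ℚ./ 1)

  overlapped⊎gapped : (σ : Repeat w) → Overlapped σ ⊎ Gapped σ
  overlapped⊎gapped σ with b₂ σ ≤? end₁ σ ℕ.+ 1
  ... | yes ov = inj₁ ov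
  ... | no ¬ov = inj₂ (≰⇒> ¬ov)

  end₂+1≡b₂+c : (σ : Repeat w) → end₂ σ ℕ.+ 1 ≡ b₂ σ ℕ.+ c σ
  end₂+1≡b₂+c σ = m∸n+n≡m (≤-trans (c≥1 σ) (m≤n+m (c σ) (b₂ σ)))

  module _ (σ σ′ : Repeat w)
           (b₁′≤b₁ : b₁ σ′ ℕ.≤ b₁ σ) (end₂≤end₂′ : end₂ σ ℕ.≤ end₂ σ′)
           (p′<p : period σ′ ℕ.< period σ) where

    b₂′<b₂ : b₂ σ′ ℕ.< b₂ σ
    b₂′<b₂ = m∸n<o∸p⇒m<o (<⇒≤ (b₁<b₂ σ′)) (<⇒≤ (b₁<b₂ σ)) b₁′≤b₁ p′<p

    c<c′ : c σ ℕ.< c σ′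
    c<c′ = o<m⇒m+n≤o+p⇒n<p b₂′<b₂
      (subst₂ ℕ._≤_ (end₂+1≡b₂+c σ) (end₂+1≡b₂+c σ′) (+-monoˡ-≤ 1 end₂≤end₂′))

    periodAtMost-transfer : ∀ α → NonNegative α → PeriodAtMost α σ → PeriodAtMost α σ′
    periodAtMost-transfer α α≥0 p≤αc = begin
      + period σ′ ℚ./ 1     ≤⟨ +/1-mono-≤ (<⇒≤ p′<p) ⟩
      + period σ ℚ./ 1      ≤⟨ p≤αc ⟩
      α ℚ.* (+ c σ ℚ./ 1)   ≤⟨ ℚ.*-monoˡ-≤-nonNeg α {{α≥0}} (+/1-mono-≤ (<⇒≤ c<c′)) ⟩
      α ℚ.* (+ c σ′ ℚ./ 1)  ∎
      where open ℚ.≤-Reasoning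

proposition10 : ∀ {a} {A : Set a} (w : List A) (α : ℚ) → 1ℚ < α →
    (σ σ′ : Repeat w) →
    Maximal σ → AlphaGapped α σ → CoveredBy σ σ′ →
    Overlapped σ′ ⊎ AlphaGapped α σ′
proposition10 w α 1<α σ σ′ _ (_ , p≤αc) (_ , _ , b₁′≤b₁ , end₂≤end₂′ , p′<p)
  with overlapped⊎gapped σ′
... | inj₁ overlapped = inj₁ overlapped
... | inj₂ gapped = inj₂ (gapped , p′≤αc′)
  where
  p′≤αc′ : PeriodAtMost α σ′
  p′≤αc′ = periodAtMost-transfer σ σ′ b₁′≤b₁ end₂≤end₂′ p′<p α (>1⇒nonNegative 1<α) p≤αc
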